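{- Let $G$ be a graph with $n$ vertices, and let $E_r$ be the edgeless graph on $r>0$ vertices. Let $G\circ E_r$ be the corona: the disjoint union of $G$ and $n$ copies of $E_r$, one copy for each vertex $v$ of $G$, where $v$ is joined to every vertex of its copy. Then $$\mathrm{ID}(G\circ E_r,x)=x^{rn}\, I(G,x^{1-r}).$$
   Context: All graphs are finite, simple and undirected. A set $W\subseteq V$ is an independent dominating set of $G=(V,E)$ if every vertex of $V\setminus W$ is adjacent to at least one vertex of $W$ and no two vertices of $W$ are adjacent. The independent domination polynomial is $\mathrm{ID}(G,x)=\sum_{W}x^{|W|}$, the sum over all independent dominating sets $W$ of $G$. The independence polynomial is $I(G,x)=\sum_{S}x^{|S|}$, the sum over all independent sets $S$ of $G$, including $\emptyset$. -}

module Defs where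

open import Data.Nat as ℕ using (ℕ; zero; suc)
open import Data.Bool using (Bool; true; false; _∧_; _∨_; not; if_then_else_)
open import Data.Fin using (Fin; splitAt; remQuot; _≟_)
open import Data.Fin.Subset using (Subset; _∈_; ∣_∣)
open import Data.Vec using (Vec; []; _∷_; lookup)
open import Data.List using (List; []; _∷_; map; _++_; allFin; foldr)
open import Data.Bool.ListAction using (all; any)
open import Data.Sum using (_⊎_; inj₁; inj₂)
open import Data.Product using (_×_; _,_)
open import Relation.Binary.PropositionalEquality using (_≡_; refl; sym)
open import Relation.Nullary using (yes; no)
open import Relation.Nullary.Decidable using (⌊_⌋)
open import Data.Empty using (⊥-elim)
open import Data.Rational using (ℚ; 0ℚ; 1ℚ; _+_; _*_)

record Graph (n : ℕ) : Set where
  field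
    adj     : Fin n → Fin n → Bool
    symm    : ∀ i j → adj i j ≡ adj j i
    irrefl  : ∀ i → adj i i ≡ false
open Graph public

allSubsets : (m : ℕ) → List (Subset m)
allSubsets zero    = [] ∷ []
allSubsets (suc m) = map (true ∷_) (allSubsets m) ++ map (false ∷_) (allSubsets m)

member : ∀ {m} → Subset m → Fin m → Bool
member W i = lookup W i

isIndependent : ∀ {m} → Graph m → Subset m → Bool
isIndependent {m} G W =
  all (λ i → all (λ j → not (member W i ∧ member W j ∧ adj G i j)) (allFin m)) (allFin m)

isDominating : ∀ {m} → Graph m → Subset m → Bool
isDominating {m} G W =
  all (λ v → member W v ∨ any (λ w → member W w ∧ adj G v w) (allFin m)) (allFin m)

isIndependentDominating : ∀ {m} → Graph m → Subset m → Bool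
isIndependentDominating G W = isIndependent G W ∧ isDominating G W

_^_ : ℚ → ℕ → ℚ
x ^ zero  = 1ℚ
x ^ suc k = x * (x ^ k)

subsetPoly : ∀ {m} → (Subset m → Bool) → ℚ → ℚ
subsetPoly {m} P x =
  foldr (λ W acc → (if P W then x ^ ∣ W ∣ else 0ℚ) + acc) 0ℚ (allSubsets m)

ID : ∀ {m} → Graph m → ℚ → ℚ
ID G = subsetPoly (isIndependentDominating G)

I : ∀ {m} → Graph m → ℚ → ℚ
I G = subsetPoly (isIndependent G)

-- Corona G ∘ E_r on vertex set Fin (n + n * r):
-- the first n vertices are those of G; vertex (v , k) (via remQuot) of the
-- second block is the k-th vertex of the copy of E_r attached to v.
data Side (n r : ℕ) : Set where
  base : Fin n → Side n r
  leaf : Fin n → Fin r → Side n r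

side : ∀ {n} r → Fin (n ℕ.+ n ℕ.* r) → Side n r
side {n} r i with splitAt n i
... | inj₁ v = base v
... | inj₂ j with remQuot r j
...   | (v , k) = leaf v k

coronaAdj : ∀ {n} → Graph n → (r : ℕ) → Side n r → Side n r → Bool
coronaAdj G r (base u)   (base v)   = adj G u v
coronaAdj G r (base u)   (leaf v _) = ⌊ u ≟ v ⌋
coronaAdj G r (leaf u _) (base v)   = ⌊ u ≟ v ⌋
coronaAdj G r (leaf _ _) (leaf _ _) = false

private
  ≟-sym : ∀ {n} (u v : Fin n) → ⌊ u ≟ v ⌋ ≡ ⌊ v ≟ u ⌋
  ≟-sym u v with u ≟ v | v ≟ u
  ... | yes _ | yes _ = refl
  ... | no _  | no _  = refl
  ... | yes p | no q  = ⊥-elim (q (sym p))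
  ... | no p  | yes q = ⊥-elim (p (sym q))

  coronaAdj-sym : ∀ {n} (G : Graph n) r (a b : Side n r) → coronaAdj G r a b ≡ coronaAdj G r b a
  coronaAdj-sym G r (base u)   (base v)   = symm G u v
  coronaAdj-sym G r (base u)   (leaf v _) = ≟-sym u v
  coronaAdj-sym G r (leaf u _) (base v)   = ≟-sym u v
  coronaAdj-sym G r (leaf _ _) (leaf _ _) = refl

  coronaAdj-irr : ∀ {n} (G : Graph n) r (a : Side n r) → coronaAdj G r a a ≡ false
  coronaAdj-irr G r (base u)   = irrefl G u
  coronaAdj-irr G r (leaf _ _) = refl

corona : ∀ {n} → Graph n → (r : ℕ) → Graph (n ℕ.+ n ℕ.* r)
corona G r = record
  { adj    = λ i j → coronaAdj G r (side r i) (side r j)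
  ; symm   = λ i j → coronaAdj-sym G r (side r i) (side r j)
  ; irrefl = λ i → coronaAdj-irr G r (side r i)
  }

module Submission where

-- A vertex set of the corona splits as A ++ C, with A ⊆ V(G) the base part
-- and C a set of leaves.  The combinatorial heart (corona-ids⇔) is: A ++ C is
-- independent dominating iff A is independent in G and C = leavesOutside r A,
-- the set of all leaves of the base vertices not in A.  Indeed a leaf of
-- v ∈ A is adjacent to v, a leaf of v ∉ A has v as its only neighbour and so
-- must itself be chosen, and conversely a base vertex v ∉ A is dominated by
-- its leaves (this needs r > 0).

open import Defs
open import Data.Nat using (ℕ; _<_; _∸_) renaming (_*_ to _*ℕ_)
open import Data.Rational using (ℚ; NonZero; 1/_; _*_)
open import Relation.Binary.PropositionalEquality using (_≡_)

open import Data.Nat using (zero; suc; s≤s; _+_)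
import Data.Nat.Properties as ℕ
open import Data.Rational using (0ℚ; 1ℚ) renaming (_+_ to _+ℚ_)
import Data.Rational.Properties as ℚ
open import Algebra.Bundles using (CommutativeRing; CommutativeMonoid)
import Algebra.Properties.CommutativeSemigroup as CommutativeSemigroupProperties
import Algebra.Properties.CommutativeSemiring.Exp as Exp
open import Data.Bool using (Bool; true; false; T; not; _∧_; _∨_; if_then_else_)
open import Data.Bool.Properties using (T-∧; T-∨; T-≡; T-not-≡)
open import Data.Bool.ListAction using (all; any)
open import Data.Fin using (Fin; splitAt; remQuot; combine; _↑ˡ_; _↑ʳ_; _≟_) renaming (zero to zeroᶠ)
import Data.Fin.Properties as Fin
open import Data.Fin.Subset using (Subset; ∣_∣)
open import Data.List using (List; []; _∷_; map; _++_; foldr; allFin)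
import Data.List.Relation.Unary.All.Properties as All
import Data.List.Relation.Unary.Any.Properties as Any
open import Data.Vec using ([]; _∷_; lookup; replicate; concat; tabulate)
  renaming (map to mapᵛ; _++_ to _++ᵛ_)
import Data.Vec.Properties as Vec
open import Data.Product using (_×_; _,_; proj₁; proj₂; ∃-syntax)
open import Data.Sum using (_⊎_; inj₁; inj₂)
open import Data.Empty using (⊥; ⊥-elim)
open import Function using (id)
open import Function.Bundles using (_⇔_; mk⇔; Equivalence)
open import Relation.Nullary using (¬_; yes; no)
open import Relation.Nullary.Decidable using (toWitness; fromWitness)
open import Relation.Binary.PropositionalEquality
  using (_≢_; refl; sym; trans; cong; cong₂; subst; subst₂; module ≡-Reasoning)

open Equivalence using (to; from)
open ≡-Reasoning
open CommutativeSemigroupProperties (CommutativeMonoid.commutativeSemigroup ℚ.*-1-commutativeMonoid)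
  using (interchange; x∙yz≈y∙xz)
module ℚ^ = Exp (CommutativeRing.commutativeSemiring ℚ.+-*-commutativeRing)

allFin⇔ : ∀ {m} (p : Fin m → Bool) → T (all p (allFin m)) ⇔ (∀ i → T (p i))
allFin⇔ p = mk⇔ (λ h → All.tabulate⁻ (All.all⁺ p _ h)) (λ h → All.all⁻ p (All.tabulate⁺ h))

anyFin⇔ : ∀ {m} (p : Fin m → Bool) → T (any p (allFin m)) ⇔ (∃[ i ] T (p i))
anyFin⇔ p = mk⇔ (λ h → Any.tabulate⁻ (Any.any⁻ p _ h)) (λ (i , h) → Any.any⁺ p (Any.tabulate⁺ i h))

not-∧∧⇔ : ∀ a b c → T (not (a ∧ b ∧ c)) ⇔ (T a → T b → c ≡ false)
not-∧∧⇔ true  true  c = mk⇔ (λ h _ _ → to T-not-≡ h) (λ h → from T-not-≡ (h _ _))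
not-∧∧⇔ true  false c = mk⇔ (λ _ _ ()) (λ _ → _)
not-∧∧⇔ false b     c = mk⇔ (λ _ ()) (λ _ → _)

T-contradiction : ∀ {a} → T a → T (not a) → ⊥
T-contradiction {true} _ ()

T-⇔⇒≡ : ∀ {a b} → T a ⇔ T b → a ≡ b
T-⇔⇒≡ {true}  {true}  _ = refl
T-⇔⇒≡ {false} {false} _ = refl
T-⇔⇒≡ {true}  {false} a⇔b = ⊥-elim (to a⇔b _)
T-⇔⇒≡ {false} {true}  a⇔b = ⊥-elim (from a⇔b _)

if-*ˡ : ∀ b c d → (if b then c * d else 0ℚ) ≡ c * (if b then d else 0ℚ)
if-*ˡ true  c d = refl
if-*ˡ false c d = sym (ℚ.*-zeroʳ c)

Independent : {S : Set} → (S → S → Bool) → (S → Bool) → Set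
Independent R mem = ∀ s t → T (mem s) → T (mem t) → R s t ≡ false

Dominating : {S : Set} → (S → S → Bool) → (S → Bool) → Set
Dominating R mem = ∀ s → T (mem s) ⊎ ∃[ t ] (T (mem t) × T (R s t))

module Relabelling {m : ℕ} {S : Set} (lab : Fin m → S) (pick : S → Fin m)
  (lab-pick : ∀ s → lab (pick s) ≡ s)
  (H : Graph m) (R : S → S → Bool) (adj-R : ∀ i j → adj H i j ≡ R (lab i) (lab j))
  (W : Subset m) (mem : S → Bool) (member-mem : ∀ i → member W i ≡ mem (lab i)) where

  independent⇔ : T (isIndependent H W) ⇔ Independent R mem
  independent⇔ = mk⇔ forward backward
    where
    clause : S → S → Bool
    clause s t = not (mem s ∧ mem t ∧ R s t)

    clause-lab : ∀ i j → not (member W i ∧ member W j ∧ adj H i j) ≡ clause (lab i) (lab j)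
    clause-lab i j rewrite member-mem i | member-mem j | adj-R i j = refl

    forward : T (isIndependent H W) → Independent R mem
    forward h s t = to (not-∧∧⇔ (mem s) (mem t) (R s t))
      (subst₂ (λ a b → T (clause a b)) (lab-pick s) (lab-pick t)
        (subst T (clause-lab (pick s) (pick t))
          (to (allFin⇔ _) (to (allFin⇔ _) h (pick s)) (pick t))))

    backward : Independent R mem → T (isIndependent H W)
    backward ind = from (allFin⇔ _) λ i → from (allFin⇔ _) λ j →
      subst T (sym (clause-lab i j))
        (from (not-∧∧⇔ (mem (lab i)) (mem (lab j)) _) (ind (lab i) (lab j)))

  dominating⇔ : T (isDominating H W) ⇔ Dominating R mem
  dominating⇔ = mk⇔ forward backward
    where
    neighbour-lab : ∀ i j → (member W j ∧ adj H i j) ≡ (mem (lab j) ∧ R (lab i) (lab j))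
    neighbour-lab i j = cong₂ _∧_ (member-mem j) (adj-R i j)

    forward-at : ∀ i → T (isDominating H W) → T (mem (lab i)) ⊎ ∃[ t ] (T (mem t) × T (R (lab i) t))
    forward-at i h with to T-∨ (to (allFin⇔ _) h i)
    ... | inj₁ i∈W = inj₁ (subst T (member-mem i) i∈W)
    ... | inj₂ hit with to (anyFin⇔ _) hit
    ...   | j , j-dom = inj₂ (lab j , to T-∧ (subst T (neighbour-lab i j) j-dom))

    forward : T (isDominating H W) → Dominating R mem
    forward h s = subst (λ s → T (mem s) ⊎ ∃[ t ] (T (mem t) × T (R s t))) (lab-pick s) (forward-at (pick s) h)

    backward-at : ∀ i → T (mem (lab i)) ⊎ ∃[ t ] (T (mem t) × T (R (lab i) t)) →
                  T (member W i ∨ any (λ j → member W j ∧ adj H i j) (allFin m))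
    backward-at i (inj₁ i∈W) = from T-∨ (inj₁ (subst T (sym (member-mem i)) i∈W))
    backward-at i (inj₂ (t , t∈W , adjacent)) = from T-∨ (inj₂ (from (anyFin⇔ _) (pick t ,
      subst T (sym (neighbour-lab i (pick t)))
        (subst (λ s → T (mem s ∧ R (lab i) s)) (sym (lab-pick t)) (from T-∧ (t∈W , adjacent))))))

    backward : Dominating R mem → T (isDominating H W)
    backward dom = from (allFin⇔ _) λ i → backward-at i (dom (lab i))

sumSubsets : (m : ℕ) → (Subset m → ℚ) → ℚ
sumSubsets zero    F = F []
sumSubsets (suc m) F = sumSubsets m (λ B → F (true ∷ B)) +ℚ sumSubsets m (λ B → F (false ∷ B))

sumList : ∀ {m} → (Subset m → ℚ) → List (Subset m) → ℚ
sumList F = foldr (λ W acc → F W +ℚ acc) 0ℚ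

sumList-++ : ∀ {m} (F : Subset m → ℚ) L₁ L₂ → sumList F (L₁ ++ L₂) ≡ sumList F L₁ +ℚ sumList F L₂
sumList-++ F []       L₂ = sym (ℚ.+-identityˡ _)
sumList-++ F (W ∷ L₁) L₂ = trans (cong (F W +ℚ_) (sumList-++ F L₁ L₂)) (sym (ℚ.+-assoc (F W) _ _))

sumList-map : ∀ {k m} (F : Subset m → ℚ) (g : Subset k → Subset m) L →
              sumList F (map g L) ≡ sumList (λ B → F (g B)) L
sumList-map F g []      = refl
sumList-map F g (B ∷ L) = cong (F (g B) +ℚ_) (sumList-map F g L)

sumList-allSubsets : ∀ m (F : Subset m → ℚ) → sumList F (allSubsets m) ≡ sumSubsets m F
sumList-allSubsets zero    F = ℚ.+-identityʳ (F [])
sumList-allSubsets (suc m) F =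
  trans (sumList-++ F (map (true ∷_) (allSubsets m)) (map (false ∷_) (allSubsets m)))
        (cong₂ _+ℚ_ (trans (sumList-map F (true ∷_) (allSubsets m)) (sumList-allSubsets m _))
                    (trans (sumList-map F (false ∷_) (allSubsets m)) (sumList-allSubsets m _)))

sumSubsets-++ : ∀ a b (F : Subset (a + b) → ℚ) →
                sumSubsets (a + b) F ≡ sumSubsets a (λ A → sumSubsets b (λ C → F (A ++ᵛ C)))
sumSubsets-++ zero    b F = refl
sumSubsets-++ (suc a) b F = cong₂ _+ℚ_ (sumSubsets-++ a b _) (sumSubsets-++ a b _)

sumSubsets-cong : ∀ m {F G : Subset m → ℚ} → (∀ B → F B ≡ G B) → sumSubsets m F ≡ sumSubsets m G
sumSubsets-cong zero    F≗G = F≗G []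
sumSubsets-cong (suc m) F≗G =
  cong₂ _+ℚ_ (sumSubsets-cong m (λ B → F≗G (true ∷ B))) (sumSubsets-cong m (λ B → F≗G (false ∷ B)))

sumSubsets-*ˡ : ∀ m c (F : Subset m → ℚ) → sumSubsets m (λ B → c * F B) ≡ c * sumSubsets m F
sumSubsets-*ˡ zero    c F = refl
sumSubsets-*ˡ (suc m) c F =
  trans (cong₂ _+ℚ_ (sumSubsets-*ˡ m c _) (sumSubsets-*ˡ m c _)) (sym (ℚ.*-distribˡ-+ c _ _))

sumSubsets-zero : ∀ m (F : Subset m → ℚ) → (∀ B → F B ≡ 0ℚ) → sumSubsets m F ≡ 0ℚ
sumSubsets-zero zero    F F≗0 = F≗0 []
sumSubsets-zero (suc m) F F≗0 =
  trans (cong₂ _+ℚ_ (sumSubsets-zero m _ (λ B → F≗0 (true ∷ B)))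
                    (sumSubsets-zero m _ (λ B → F≗0 (false ∷ B))))
        (ℚ.+-identityʳ 0ℚ)

sumSubsets-delta : ∀ m (B₀ : Subset m) (F : Subset m → ℚ) → (∀ B → B ≢ B₀ → F B ≡ 0ℚ) →
                   sumSubsets m F ≡ F B₀
sumSubsets-delta zero    []          F vanish = refl
sumSubsets-delta (suc m) (true ∷ B₀) F vanish =
  trans (cong₂ _+ℚ_ (sumSubsets-delta m B₀ _ λ B B≢B₀ → vanish _ (λ eq → B≢B₀ (Vec.∷-injectiveʳ eq)))
                    (sumSubsets-zero m _ λ B → vanish _ λ ()))
        (ℚ.+-identityʳ _)
sumSubsets-delta (suc m) (false ∷ B₀) F vanish =
  trans (cong₂ _+ℚ_ (sumSubsets-zero m _ λ B → vanish _ λ ())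
                    (sumSubsets-delta m B₀ _ λ B B≢B₀ → vanish _ (λ eq → B≢B₀ (Vec.∷-injectiveʳ eq))))
        (ℚ.+-identityˡ _)

monomial : ∀ {m} → (Subset m → Bool) → ℚ → Subset m → ℚ
monomial P x W = if P W then x ^ ∣ W ∣ else 0ℚ

subsetPoly-sum : ∀ {m} (P : Subset m → Bool) x → subsetPoly P x ≡ sumSubsets m (monomial P x)
subsetPoly-sum {m} P x = sumList-allSubsets m (monomial P x)

monomial-off : ∀ {m} (P : Subset m → Bool) x W → ¬ T (P W) → monomial P x W ≡ 0ℚ
monomial-off P x W W∉P with P W
... | true  = ⊥-elim (W∉P _)
... | false = refl

leavesOutside : ∀ {n} r → Subset n → Subset (n *ℕ r)
leavesOutside r A = concat (mapᵛ (λ b → replicate r (not b)) A)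

lookup-leavesOutside : ∀ {n} r (A : Subset n) v k →
                       lookup (leavesOutside r A) (combine v k) ≡ not (lookup A v)
lookup-leavesOutside r A v k = begin
  lookup (leavesOutside r A) (combine v k)                ≡⟨ Vec.lookup-concat (mapᵛ (λ b → replicate r (not b)) A) v k ⟩
  lookup (lookup (mapᵛ (λ b → replicate r (not b)) A) v) k ≡⟨ cong (λ l → lookup l k) (Vec.lookup-map v _ A) ⟩
  lookup (replicate r (not (lookup A v))) k               ≡⟨ Vec.lookup-replicate k _ ⟩
  not (lookup A v)                                        ∎

leavesOutside-unique : ∀ {n} r (A : Subset n) (C : Subset (n *ℕ r)) →
  (∀ v k → lookup C (combine v k) ≡ not (lookup A v)) → C ≡ leavesOutside r A
leavesOutside-unique {n} r A C leaves = begin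
  C                                     ≡⟨ Vec.tabulate∘lookup C ⟨
  tabulate (lookup C)                   ≡⟨ Vec.tabulate-cong same ⟩
  tabulate (lookup (leavesOutside r A)) ≡⟨ Vec.tabulate∘lookup _ ⟩
  leavesOutside r A                     ∎
  where
  same : ∀ j → lookup C j ≡ lookup (leavesOutside r A) j
  same j = subst (λ i → lookup C i ≡ lookup (leavesOutside r A) i) (Fin.combine-remQuot {n} r j)
    (trans (leaves v k) (sym (lookup-leavesOutside r A v k)))
    where
    v : Fin n
    v = proj₁ (remQuot {n} r j)
    k : Fin r
    k = proj₂ (remQuot {n} r j)

sideMember : ∀ {n r} → Subset n → (Fin n → Fin r → Bool) → Side n r → Bool
sideMember A L (base v)   = lookup A v
sideMember A L (leaf v k) = L v k

leafLabel : ∀ {n r} → Subset (n *ℕ r) → Fin n → Fin r → Bool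
leafLabel C v k = lookup C (combine v k)

vertex : ∀ {n r} → Side n r → Fin (n + n *ℕ r)
vertex {n} {r} (base u)   = u ↑ˡ (n *ℕ r)
vertex {n} {r} (leaf v k) = n ↑ʳ combine v k

side-vertex : ∀ {n r} (s : Side n r) → side r (vertex s) ≡ s
side-vertex {n} {r} (base u) rewrite Fin.splitAt-↑ˡ n u (n *ℕ r) = refl
side-vertex {n} {r} (leaf v k) =
  trans (side-↑ʳ (combine v k)) (cong (λ (u , l) → leaf u l) (Fin.remQuot-combine v k))
  where
  side-↑ʳ : ∀ j → side r (n ↑ʳ j) ≡ leaf (proj₁ (remQuot {n} r j)) (proj₂ (remQuot {n} r j))
  side-↑ʳ j rewrite Fin.splitAt-↑ʳ n (n *ℕ r) j = refl

member-side : ∀ {n} r (A : Subset n) (C : Subset (n *ℕ r)) i →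
              member (A ++ᵛ C) i ≡ sideMember A (leafLabel C) (side r i)
member-side {n} r A C i rewrite Vec.lookup-splitAt n A C i with splitAt n i
... | inj₁ v = refl
... | inj₂ j = cong (lookup C) (sym (Fin.combine-remQuot {n} r j))

leaf-base-adjacent : ∀ {n r} (G : Graph n) (v : Fin n) (k : Fin r) → T (coronaAdj G r (leaf v k) (base v))
leaf-base-adjacent G v k = fromWitness refl

-- The corona characterisation on Side: if the base set A together with the
-- leaves labelled by L is independent and dominating, then A is independent
-- in G and exactly the leaves of vertices outside A are chosen (a leaf of
-- v ∈ A is adjacent to v; a leaf of v ∉ A has no other neighbour, so it must
-- dominate itself).
corona-ids⇒ : ∀ {n r} (G : Graph n) (A : Subset n) (L : Fin n → Fin r → Bool) →
  Independent (coronaAdj G r) (sideMember A L) → Dominating (coronaAdj G r) (sideMember A L) →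
  Independent (adj G) (lookup A) × (∀ v k → L v k ≡ not (lookup A v))
corona-ids⇒ G A L ind dom = (λ u v → ind (base u) (base v)) , leaves
  where
  leaves : ∀ v k → L v k ≡ not (lookup A v)
  leaves v k with lookup A v in v∈A
  ... | true with L v k in leaf∈
  ...   | false = refl
  ...   | true  = ⊥-elim (subst T (ind (leaf v k) (base v) (from T-≡ leaf∈) (from T-≡ v∈A))
                                  (leaf-base-adjacent G v k))
  leaves v k | false with dom (leaf v k)
  ... | inj₁ leaf∈ = to T-≡ leaf∈
  ... | inj₂ (leaf _ _ , _ , ())
  ... | inj₂ (base u , u∈A , v≟u) =
    ⊥-elim (subst T v∈A (subst (λ w → T (lookup A w)) (sym (toWitness v≟u)) u∈A))

-- Conversely, such a labelling gives an independent dominating set, provided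
-- every base vertex has at least one leaf (r > 0) to dominate it when v ∉ A.
corona-ids⇐ : ∀ {n r} (G : Graph n) (A : Subset n) (L : Fin n → Fin r → Bool) → Fin r →
  Independent (adj G) (lookup A) → (∀ v k → L v k ≡ not (lookup A v)) →
  Independent (coronaAdj G r) (sideMember A L) × Dominating (coronaAdj G r) (sideMember A L)
corona-ids⇐ {r = r} G A L k₀ indA leaves = ind , dom
  where
  leaf∉ : ∀ v k → T (L v k) → T (lookup A v) → ⊥
  leaf∉ v k leaf∈ v∈A = T-contradiction v∈A (subst T (leaves v k) leaf∈)

  ind : Independent (coronaAdj G r) (sideMember A L)
  ind (base u)   (base v)   = indA u v
  ind (base u)   (leaf v k) u∈A leaf∈ with u ≟ v
  ... | no _     = refl
  ... | yes refl = ⊥-elim (leaf∉ u k leaf∈ u∈A)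
  ind (leaf u k) (base v)   leaf∈ v∈A with u ≟ v
  ... | no _     = refl
  ... | yes refl = ⊥-elim (leaf∉ u k leaf∈ v∈A)
  ind (leaf _ _) (leaf _ _) _ _ = refl

  dom : Dominating (coronaAdj G r) (sideMember A L)
  dom (base v) with lookup A v in v∈A
  ... | true  = inj₁ _
  ... | false = inj₂ (leaf v k₀ , from T-≡ (trans (leaves v k₀) (cong not v∈A)) , leaf-base-adjacent G v k₀)
  dom (leaf v k) with lookup A v in v∈A
  ... | false = inj₁ (from T-≡ (trans (leaves v k) (cong not v∈A)))
  ... | true  = inj₂ (base v , from T-≡ v∈A , leaf-base-adjacent G v k)

isIndependent⇔ : ∀ {n} (G : Graph n) (A : Subset n) → T (isIndependent G A) ⇔ Independent (adj G) (lookup A)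
isIndependent⇔ G A = Relabelling.independent⇔ id id (λ _ → refl) G (adj G) (λ _ _ → refl) A (lookup A) (λ _ → refl)

corona-ids⇔ : ∀ {n r} (G : Graph n) → Fin r → (A : Subset n) (C : Subset (n *ℕ r)) →
  T (isIndependentDominating (corona G r) (A ++ᵛ C)) ⇔ (T (isIndependent G A) × C ≡ leavesOutside r A)
corona-ids⇔ {n} {r} G k₀ A C = mk⇔ forward backward
  where
  open Relabelling (side r) vertex side-vertex (corona G r) (coronaAdj G r) (λ _ _ → refl)
                   (A ++ᵛ C) (sideMember A (leafLabel C)) (member-side r A C)

  leaves : C ≡ leavesOutside r A → ∀ v k → leafLabel C v k ≡ not (lookup A v)
  leaves C≡ v k = trans (cong (λ D → lookup D (combine v k)) C≡) (lookup-leavesOutside r A v k)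

  forward : T (isIndependentDominating (corona G r) (A ++ᵛ C)) → T (isIndependent G A) × C ≡ leavesOutside r A
  forward h =
    let isInd , isDom = to T-∧ h
        indA  , leaf≡ = corona-ids⇒ G A (leafLabel C) (to independent⇔ isInd) (to dominating⇔ isDom)
    in from (isIndependent⇔ G A) indA , leavesOutside-unique r A C leaf≡

  backward : T (isIndependent G A) × C ≡ leavesOutside r A → T (isIndependentDominating (corona G r) (A ++ᵛ C))
  backward (indA , C≡) =
    let ind , dom = corona-ids⇐ G A (leafLabel C) k₀ (to (isIndependent⇔ G A) indA) (leaves C≡)
    in from T-∧ (from independent⇔ ind , from dominating⇔ dom)

^-agrees : ∀ x n → x ^ n ≡ x ℚ^.^ n
^-agrees x zero    = refl
^-agrees x (suc n) = cong (x *_) (^-agrees x n)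

^-+ : ∀ x m n → x ^ (m + n) ≡ x ^ m * x ^ n
^-+ x m n = begin
  x ^ (m + n)              ≡⟨ ^-agrees x (m + n) ⟩
  x ℚ^.^ (m + n)           ≡⟨ ℚ^.^-homo-* x m n ⟩
  x ℚ^.^ m * x ℚ^.^ n      ≡⟨ cong₂ _*_ (^-agrees x m) (^-agrees x n) ⟨
  x ^ m * x ^ n            ∎

-- x^{1+k} · x^{-k} = x: the exponent x^{1-r} of the theorem, for r = 1 + k.
^-suc-inverse : ∀ x .{{_ : NonZero x}} k → x ^ suc k * (1/ x) ^ k ≡ x
^-suc-inverse x zero    = trans (ℚ.*-identityʳ _) (ℚ.*-identityʳ x)
^-suc-inverse x (suc k) = begin
  (x * x ^ suc k) * ((1/ x) * (1/ x) ^ k) ≡⟨ interchange x _ _ _ ⟩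
  (x * 1/ x) * (x ^ suc k * (1/ x) ^ k)   ≡⟨ cong₂ _*_ (ℚ.*-inverseʳ x) (^-suc-inverse x k) ⟩
  1ℚ * x                                  ≡⟨ ℚ.*-identityˡ x ⟩
  x                                       ∎

^∣++∣ : ∀ x {a b} (B : Subset a) (C : Subset b) → x ^ ∣ B ++ᵛ C ∣ ≡ x ^ ∣ B ∣ * x ^ ∣ C ∣
^∣++∣ x []          C = sym (ℚ.*-identityˡ _)
^∣++∣ x (true  ∷ B) C = trans (cong (x *_) (^∣++∣ x B C)) (sym (ℚ.*-assoc x _ _))
^∣++∣ x (false ∷ B) C = ^∣++∣ x B C

^∣replicate∣ : ∀ x r b → x ^ ∣ replicate r b ∣ ≡ (if b then x ^ r else 1ℚ)
^∣replicate∣ x zero    true  = refl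
^∣replicate∣ x zero    false = refl
^∣replicate∣ x (suc r) true  = cong (x *_) (^∣replicate∣ x r true)
^∣replicate∣ x (suc r) false = ^∣replicate∣ x r false

-- Weight of the independent dominating set A ++ leavesOutside r A: each base
-- vertex contributes x (if in A) or x^r (its r leaves); with x = x^r · y
-- this is x^{rn} y^{|A|}.
leaves-weight : ∀ x y r → x ^ r * y ≡ x → ∀ {n} (A : Subset n) →
                x ^ ∣ A ++ᵛ leavesOutside r A ∣ ≡ x ^ (r *ℕ n) * y ^ ∣ A ∣
leaves-weight x y r x^r*y≡x A = trans (^∣++∣ x A (leavesOutside r A)) (split-weight A)
  where
  one-more : ∀ n → x ^ r * x ^ (r *ℕ n) ≡ x ^ (r *ℕ suc n)
  one-more n = trans (sym (^-+ x r (r *ℕ n))) (cong (x ^_) (sym (ℕ.*-suc r n)))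

  split-weight : ∀ {n} (A : Subset n) → x ^ ∣ A ∣ * x ^ ∣ leavesOutside r A ∣ ≡ x ^ (r *ℕ n) * y ^ ∣ A ∣
  split-weight [] rewrite ℕ.*-zeroʳ r = refl
  split-weight {suc n} (true ∷ A) = begin
    (x * x ^ ∣ A ∣) * x ^ ∣ replicate r false ++ᵛ L ∣
      ≡⟨ cong ((x * x ^ ∣ A ∣) *_) (^∣++∣ x (replicate r false) L) ⟩
    (x * x ^ ∣ A ∣) * (x ^ ∣ replicate r false ∣ * x ^ ∣ L ∣)
      ≡⟨ cong (λ w → (x * x ^ ∣ A ∣) * (w * x ^ ∣ L ∣)) (^∣replicate∣ x r false) ⟩
    (x * x ^ ∣ A ∣) * (1ℚ * x ^ ∣ L ∣)   ≡⟨ cong ((x * x ^ ∣ A ∣) *_) (ℚ.*-identityˡ _) ⟩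
    (x * x ^ ∣ A ∣) * x ^ ∣ L ∣          ≡⟨ ℚ.*-assoc x _ _ ⟩
    x * (x ^ ∣ A ∣ * x ^ ∣ L ∣)          ≡⟨ cong₂ _*_ (sym x^r*y≡x) (split-weight A) ⟩
    (x ^ r * y) * (x ^ (r *ℕ n) * y ^ ∣ A ∣) ≡⟨ interchange (x ^ r) y _ _ ⟩
    (x ^ r * x ^ (r *ℕ n)) * (y * y ^ ∣ A ∣) ≡⟨ cong (_* (y * y ^ ∣ A ∣)) (one-more n) ⟩
    x ^ (r *ℕ suc n) * (y * y ^ ∣ A ∣)   ∎
    where
    L : Subset (n *ℕ r)
    L = leavesOutside r A
  split-weight {suc n} (false ∷ A) = begin
    x ^ ∣ A ∣ * x ^ ∣ replicate r true ++ᵛ L ∣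
      ≡⟨ cong (x ^ ∣ A ∣ *_) (^∣++∣ x (replicate r true) L) ⟩
    x ^ ∣ A ∣ * (x ^ ∣ replicate r true ∣ * x ^ ∣ L ∣)
      ≡⟨ cong (λ w → x ^ ∣ A ∣ * (w * x ^ ∣ L ∣)) (^∣replicate∣ x r true) ⟩
    x ^ ∣ A ∣ * (x ^ r * x ^ ∣ L ∣)      ≡⟨ x∙yz≈y∙xz (x ^ ∣ A ∣) (x ^ r) (x ^ ∣ L ∣) ⟩
    x ^ r * (x ^ ∣ A ∣ * x ^ ∣ L ∣)      ≡⟨ cong (x ^ r *_) (split-weight A) ⟩
    x ^ r * (x ^ (r *ℕ n) * y ^ ∣ A ∣)   ≡⟨ ℚ.*-assoc (x ^ r) _ _ ⟨
    (x ^ r * x ^ (r *ℕ n)) * y ^ ∣ A ∣   ≡⟨ cong (_* y ^ ∣ A ∣) (one-more n) ⟩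
    x ^ (r *ℕ suc n) * y ^ ∣ A ∣         ∎
    where
    L : Subset (n *ℕ r)
    L = leavesOutside r A

-- Fixing the base part A, the only leaf set completing it to an independent
-- dominating set is leavesOutside r A, so the inner sum of ID(G ∘ E_r) over
-- leaf sets has at most one term.
fibre-sum : ∀ {n r} (G : Graph n) → Fin r → ∀ x y → x ^ r * y ≡ x → (A : Subset n) →
  sumSubsets (n *ℕ r) (λ C → monomial (isIndependentDominating (corona G r)) x (A ++ᵛ C))
    ≡ x ^ (r *ℕ n) * monomial (isIndependent G) y A
fibre-sum {n} {r} G k₀ x y x^r*y≡x A = begin
  sumSubsets (n *ℕ r) (λ C → monomial IDS x (A ++ᵛ C))
    ≡⟨ sumSubsets-delta (n *ℕ r) L _ (λ C C≢L → monomial-off IDS x (A ++ᵛ C)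
         (λ ids → C≢L (proj₂ (to (corona-ids⇔ G k₀ A C) ids)))) ⟩
  (if IDS (A ++ᵛ L) then x ^ ∣ A ++ᵛ L ∣ else 0ℚ)
    ≡⟨ cong (λ b → if b then x ^ ∣ A ++ᵛ L ∣ else 0ℚ) (T-⇔⇒≡ ids⇔independent) ⟩
  (if isIndependent G A then x ^ ∣ A ++ᵛ L ∣ else 0ℚ)
    ≡⟨ cong (λ w → if isIndependent G A then w else 0ℚ) (leaves-weight x y r x^r*y≡x A) ⟩
  (if isIndependent G A then x ^ (r *ℕ n) * y ^ ∣ A ∣ else 0ℚ)
    ≡⟨ if-*ˡ (isIndependent G A) (x ^ (r *ℕ n)) (y ^ ∣ A ∣) ⟩
  x ^ (r *ℕ n) * monomial (isIndependent G) y A ∎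
  where
  IDS : Subset (n + n *ℕ r) → Bool
  IDS = isIndependentDominating (corona G r)
  L : Subset (n *ℕ r)
  L = leavesOutside r A
  ids⇔independent : T (IDS (A ++ᵛ L)) ⇔ T (isIndependent G A)
  ids⇔independent = mk⇔ (λ ids → proj₁ (to (corona-ids⇔ G k₀ A L) ids))
                        (λ ind → from (corona-ids⇔ G k₀ A L) (ind , refl))

mainTheorem4 : (n : ℕ) (G : Graph n) (r : ℕ) → 0 < r →
    (x : ℚ) .{{_ : NonZero x}} →
    ID (corona G r) x ≡ (x ^ (r *ℕ n)) * I G ((1/ x) ^ (r ∸ 1))
mainTheorem4 n G r@(suc k) (s≤s _) x = begin
  ID (corona G r) x
    ≡⟨ subsetPoly-sum (isIndependentDominating (corona G r)) x ⟩
  sumSubsets (n + n *ℕ r) (monomial (isIndependentDominating (corona G r)) x)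
    ≡⟨ sumSubsets-++ n (n *ℕ r) _ ⟩
  sumSubsets n (λ A → sumSubsets (n *ℕ r) (λ C → monomial (isIndependentDominating (corona G r)) x (A ++ᵛ C)))
    ≡⟨ sumSubsets-cong n (fibre-sum G zeroᶠ x y (^-suc-inverse x k)) ⟩
  sumSubsets n (λ A → x ^ (r *ℕ n) * monomial (isIndependent G) y A)
    ≡⟨ sumSubsets-*ˡ n (x ^ (r *ℕ n)) _ ⟩
  x ^ (r *ℕ n) * sumSubsets n (monomial (isIndependent G) y)
    ≡⟨ cong (x ^ (r *ℕ n) *_) (subsetPoly-sum (isIndependent G) y) ⟨
  x ^ (r *ℕ n) * I G y ∎
  where
  y : ℚ
  y = (1/ x) ^ k
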